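{- Let $\mathcal G$ be a nearly-disjoint $l$-uniform hypergraph on $n$ vertices (any two distinct edges share at most one vertex), and let $\delta>0$. For a set $e$, let $I(e,\mathcal G)=|\{g\in\mathcal G : e\cap g\ne\emptyset\}|$. Then \[ \bigl|\{e\in\mathcal G : I(e,\mathcal G)<\delta|\mathcal G|l^2/n\}\bigr|<\delta|\mathcal G|+n/l. \]
   Context: Here $|\mathcal G|$ denotes the number of edges of $\mathcal G$; note that for $e\in\mathcal G$, $I(e,\mathcal G)$ counts $e$ itself.
   Formalization: The parameter δ ranges over the positive rationals. -}

module Defs where

open import Data.Nat using (ℕ; _≤_; NonZero)
open import Data.Fin using (Fin)
open import Data.Fin.Subset using (Subset; _∩_; ∣_∣)
open import Data.Fin.Subset.Properties using (nonempty?)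
open import Data.Vec using (tabulate)
open import Data.Integer using (+_)
open import Data.Rational using (ℚ; _/_; _*_; _<?_)
open import Data.Product using (_×_)
open import Function.Definitions using (Injective)
open import Relation.Binary.PropositionalEquality using (_≡_; _≢_)
open import Relation.Nullary using (does)

-- A hypergraph on vertex set Fin n with m edges, given as an injective
-- family of edges  G : Fin m → Subset n  (so |G| = m).

ℕ→ℚ : ℕ → ℚ
ℕ→ℚ k = (+ k) / 1

IsNearlyDisjointUniform : ∀ {n m} → ℕ → (Fin m → Subset n) → Set
IsNearlyDisjointUniform l G =
  Injective _≡_ _≡_ G
  × (∀ i → ∣ G i ∣ ≡ l)
  × (∀ i j → i ≢ j → ∣ G i ∩ G j ∣ ≤ 1)

I : ∀ {n m} → Subset n → (Fin m → Subset n) → ℕ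
I e G = ∣ tabulate (λ j → does (nonempty? (e ∩ G j))) ∣

lowCount : ∀ {n m} (l : ℕ) → .{{NonZero n}} → ℚ → (Fin m → Subset n) → ℕ
lowCount {n} {m} l δ G =
  ∣ tabulate (λ i → does (ℕ→ℚ (I (G i) G) <? δ * ((+ (m Data.Nat.* l Data.Nat.* l)) / n))) ∣

module Submission where

-- Let L be the set of "low" edges e (those with I(e,G) < X, where
-- X = δ|G|l²/n), c = |L| and d_L(v) the number of low edges through v.
-- Double counting gives  Σ_v d_L(v) = c·l,  and for every edge e
--   Σ_{v ∈ e} deg(v) = Σ_{g ∈ G} |e ∩ g| ≤ I(e,G) + l
-- because distinct edges meet in at most one vertex.  Hence
--   Σ_v d_L(v)² ≤ Σ_{e ∈ L} Σ_{v ∈ e} deg(v) ≤ c·(Y + l),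
-- where Y is the largest I(e,G) over e ∈ L, and Cauchy–Schwarz yields
--   (c·l)² ≤ n · Σ_v d_L(v)² ≤ n·c·(Y + l),  i.e.  c·l² ≤ n·(Y + l).
-- Since Y < X this is the claim  c < δ|G| + n/l  after dividing by l².

open import Defs
open import Data.Nat using (ℕ)
open import Data.Fin using (Fin)
open import Data.Fin.Subset using (Subset)

module FiniteSums where

  open import Data.Nat
  open import Data.Nat.Properties
  open import Data.Fin using (zero; suc; punchIn)
  open import Data.Product using (_,_)
  open import Data.Sum using (inj₁; inj₂)
  open import Data.Nat.Solver using (module +-*-Solver)
  open +-*-Solver using (solve; _:*_; _:+_; _:=_; con)
  open import Function using (_∘_)
  open import Data.Fin.Properties using (punchInᵢ≢i)
  open import Relation.Binary.PropositionalEquality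
  open import Algebra.Properties.Semiring.Sum +-*-semiring public
    using (sum; sum-syntax; sum-cong-≗; sum-remove; ∑-distrib-+; ∑-comm; *-distribˡ-sum; *-distribʳ-sum)

  ∑-mono-≤ : ∀ {k} {f g : Fin k → ℕ} → (∀ i → f i ≤ g i) → sum f ≤ sum g
  ∑-mono-≤ {zero}  f≤g = z≤n
  ∑-mono-≤ {suc k} f≤g = +-mono-≤ (f≤g zero) (∑-mono-≤ (f≤g ∘ suc))

  ∑-const : ∀ k a → ∑[ i < k ] a ≡ k * a
  ∑-const zero    a = refl
  ∑-const (suc k) a = cong (a +_) (∑-const k a)

  ∑-≤-except : ∀ {k} (i : Fin k) {f g : Fin k → ℕ} →
               (∀ j → j ≢ i → f j ≤ g j) → sum f ≤ sum g + f i
  ∑-≤-except {suc k} i {f} {g} f≤g = begin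
    sum f                                 ≡⟨ sum-remove {i = i} f ⟩
    f i + ∑[ j < k ] f (punchIn i j)      ≤⟨ +-monoʳ-≤ (f i) (∑-mono-≤ (λ j → f≤g _ (punchInᵢ≢i i j))) ⟩
    f i + ∑[ j < k ] g (punchIn i j)      ≤⟨ +-monoʳ-≤ (f i) (m≤n+m _ (g i)) ⟩
    f i + (g i + ∑[ j < k ] g (punchIn i j)) ≡⟨ cong (f i +_) (sum-remove {i = i} g) ⟨
    f i + sum g                           ≡⟨ +-comm (f i) (sum g) ⟩
    sum g + f i                           ∎
    where open ≤-Reasoning

  -- AM–GM for two natural numbers, first for an ordered pair  x ≤ x + d:
  -- the difference of the two sides is  d².
  am-gm-ordered : ∀ x d → 2 * (x * (x + d)) ≤ x * x + (x + d) * (x + d)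
  am-gm-ordered x d = begin
    2 * (x * (x + d))            ≤⟨ m≤m+n _ (d * d) ⟩
    2 * (x * (x + d)) + d * d    ≡⟨ solve 2 (λ x d → con 2 :* (x :* (x :+ d)) :+ d :* d
                                      := x :* x :+ (x :+ d) :* (x :+ d)) refl x d ⟩
    x * x + (x + d) * (x + d)    ∎
    where open ≤-Reasoning

  am-gm : ∀ x y → 2 * (x * y) ≤ x * x + y * y
  am-gm x y with ≤-total x y
  ... | inj₁ x≤y with d , refl ← m≤n⇒∃[o]m+o≡n x≤y = am-gm-ordered x d
  ... | inj₂ y≤x with d , refl ← m≤n⇒∃[o]m+o≡n y≤x =
    subst₂ _≤_ (cong (2 *_) (*-comm y x)) (+-comm (y * y) (x * x)) (am-gm-ordered y d)

  -- Cauchy–Schwarz:  (Σ f)² ≤ k · Σ f².  Expand the square as a double sum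
  -- and apply AM–GM to each product  f u · f v.
  cauchy-schwarz : ∀ {k} (f : Fin k → ℕ) → sum f * sum f ≤ k * ∑[ v < k ] (f v * f v)
  cauchy-schwarz {k} f = *-cancelˡ-≤ 2 (begin
    2 * (S * S)                                            ≡⟨ cong (2 *_) square ⟩
    2 * ∑[ u < k ] ∑[ v < k ] (f u * f v)                  ≡⟨ *-distribˡ-sum 2 (λ u → ∑[ v < k ] (f u * f v)) ⟩
    ∑[ u < k ] (2 * ∑[ v < k ] (f u * f v))                ≡⟨ sum-cong-≗ (λ u → *-distribˡ-sum 2 (λ v → f u * f v)) ⟩
    ∑[ u < k ] ∑[ v < k ] (2 * (f u * f v))                ≤⟨ ∑-mono-≤ (λ u → ∑-mono-≤ (λ v → am-gm (f u) (f v))) ⟩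
    ∑[ u < k ] ∑[ v < k ] (f u * f u + f v * f v)          ≡⟨ sum-cong-≗ (λ u → ∑-distrib-+ (λ _ → f u * f u) (λ v → f v * f v)) ⟩
    ∑[ u < k ] (∑[ v < k ] (f u * f u) + Q)                ≡⟨ ∑-distrib-+ (λ u → ∑[ v < k ] (f u * f u)) (λ _ → Q) ⟩
    ∑[ u < k ] ∑[ v < k ] (f u * f u) + ∑[ u < k ] Q       ≡⟨ cong₂ _+_ diagonal (∑-const k Q) ⟩
    k * Q + k * Q                                          ≡⟨ cong (k * Q +_) (+-identityʳ (k * Q)) ⟨
    2 * (k * Q)                                            ∎)
    where
    open ≤-Reasoning
    S = sum f
    Q = ∑[ v < k ] (f v * f v)
    square : S * S ≡ ∑[ u < k ] ∑[ v < k ] (f u * f v)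
    square = trans (*-distribʳ-sum S f) (sum-cong-≗ (λ u → *-distribˡ-sum (f u) f))
    diagonal : ∑[ u < k ] ∑[ v < k ] (f u * f u) ≡ k * Q
    diagonal = trans (sum-cong-≗ (λ u → ∑-const k (f u * f u))) (sym (*-distribˡ-sum k (λ u → f u * f u)))

module SubsetCardinality where

  open FiniteSums
  open import Data.Nat
  open import Data.Nat.Properties
  open import Data.Bool using (Bool; true; false; _∧_; T)
  open import Data.Vec using (_∷_; []; lookup; tabulate)
  open import Data.Vec.Properties using (lookup∘tabulate; lookup-zipWith)
  open import Data.Fin.Subset using (_∩_; ∣_∣)
  open import Data.Fin.Subset.Properties using (nonempty?; Empty-unique; ∣⊥∣≡0)
  open import Relation.Nullary using (does; yes; no; ¬_; contradiction)
  open import Relation.Binary.PropositionalEquality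
  open import Function using (_∘_)

  χ : Bool → ℕ
  χ true  = 1
  χ false = 0

  χ-∧ : ∀ a b → χ (a ∧ b) ≡ χ a * χ b
  χ-∧ true  b = sym (+-identityʳ (χ b))
  χ-∧ false b = refl

  χ≤1 : ∀ b → χ b ≤ 1
  χ≤1 true  = ≤-refl
  χ≤1 false = z≤n

  χ-guard : ∀ b {x y} → (T b → x ≤ y) → χ b * x ≤ χ b * y
  χ-guard true  x≤y = +-monoˡ-≤ 0 (x≤y _)
  χ-guard false x≤y = z≤n

  ∑χ-none : ∀ {k} (b : Fin k → Bool) → (∀ i → ¬ T (b i)) → ∑[ i < k ] χ (b i) ≡ 0
  ∑χ-none {k} b none = trans (sum-cong-≗ (χ-off ∘ none)) (trans (∑-const k 0) (*-zeroʳ k))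
    where
    χ-off : ∀ {b} → ¬ T b → χ b ≡ 0
    χ-off {true}  ¬t = contradiction _ ¬t
    χ-off {false} _  = refl

  ∣p∣≡∑ : ∀ {n} (p : Subset n) → ∣ p ∣ ≡ ∑[ v < n ] χ (lookup p v)
  ∣p∣≡∑ []          = refl
  ∣p∣≡∑ (true  ∷ p) = cong suc (∣p∣≡∑ p)
  ∣p∣≡∑ (false ∷ p) = ∣p∣≡∑ p

  ∣tabulate∣≡∑ : ∀ {n} (b : Fin n → Bool) → ∣ tabulate b ∣ ≡ ∑[ v < n ] χ (b v)
  ∣tabulate∣≡∑ b = trans (∣p∣≡∑ (tabulate b)) (sum-cong-≗ (cong χ ∘ lookup∘tabulate b))

  ∣p∩q∣≡∑ : ∀ {n} (p q : Subset n) → ∣ p ∩ q ∣ ≡ ∑[ v < n ] (χ (lookup p v) * χ (lookup q v))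
  ∣p∩q∣≡∑ p q = trans (∣p∣≡∑ (p ∩ q))
    (sum-cong-≗ (λ v → trans (cong χ (lookup-zipWith _∧_ v p q)) (χ-∧ (lookup p v) (lookup q v))))

  ∣p∣≤χ[nonempty] : ∀ {n} (p : Subset n) → ∣ p ∣ ≤ 1 → ∣ p ∣ ≤ χ (does (nonempty? p))
  ∣p∣≤χ[nonempty] {n} p ∣p∣≤1 with nonempty? p
  ... | yes _     = ∣p∣≤1
  ... | no  empty = ≤-reflexive (trans (cong ∣_∣ (Empty-unique empty)) (∣⊥∣≡0 n))

module Selection where

  open import Data.Nat
  open import Data.Nat.Properties
  open import Data.Bool using (Bool; T; T?)
  open import Data.Fin using (zero; suc)
  open import Data.Product using (∃-syntax; _×_; _,_)
  open import Data.Sum using (_⊎_; inj₁; inj₂)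
  open import Relation.Nullary using (Dec; does; ¬_; yes; no; contradiction)
  open import Function using (_∘_)

  does-sound : ∀ {p} {P : Set p} (d : Dec P) → T (does d) → P
  does-sound (yes p) _ = p
  does-sound (no _)  ()

  selected-max : ∀ {k} (b : Fin k → Bool) (f : Fin k → ℕ) →
    (∀ i → ¬ T (b i)) ⊎ ∃[ i₀ ] (T (b i₀) × (∀ j → T (b j) → f j ≤ f i₀))
  selected-max {zero}  b f = inj₁ λ ()
  selected-max {suc k} b f with T? (b zero) | selected-max (b ∘ suc) (f ∘ suc)
  ... | no ¬b₀ | inj₁ none = inj₁ λ { zero → ¬b₀ ; (suc i) → none i }
  ... | no ¬b₀ | inj₂ (i , bᵢ , max) =
    inj₂ (suc i , bᵢ , λ { zero b₀ → contradiction b₀ ¬b₀ ; (suc j) bⱼ → max j bⱼ })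
  ... | yes b₀ | inj₁ none =
    inj₂ (zero , b₀ , λ { zero _ → ≤-refl ; (suc j) bⱼ → contradiction bⱼ (none j) })
  ... | yes b₀ | inj₂ (i , bᵢ , max) with f (suc i) ≤? f zero
  ...   | yes fᵢ≤f₀ = inj₂ (zero , b₀ , λ { zero _ → ≤-refl ; (suc j) bⱼ → ≤-trans (max j bⱼ) fᵢ≤f₀ })
  ...   | no  fᵢ≰f₀ = inj₂ (suc i , bᵢ , λ { zero _ → <⇒≤ (≰⇒> fᵢ≰f₀) ; (suc j) bⱼ → max j bⱼ })

module Incidences {n m : ℕ} (G : Fin m → Subset n) where

  open FiniteSums
  open SubsetCardinality
  open import Data.Nat
  open import Data.Nat.Properties
  open import Data.Bool using (Bool)
  open import Data.Vec using (lookup)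
  open import Data.Fin.Subset using (_∩_; ∣_∣)
  open import Data.Fin.Subset.Properties using (∣p∩q∣≤∣p∣; nonempty?)
  open import Relation.Nullary using (does)
  open import Relation.Binary.PropositionalEquality
  open import Function using (_∘_)

  inc : Fin m → Fin n → ℕ
  inc i v = χ (lookup (G i) v)

  deg : Fin n → ℕ
  deg v = ∑[ i < m ] inc i v

  ∑-deg-over-edge : ∀ i → ∑[ v < n ] (inc i v * deg v) ≡ ∑[ j < m ] ∣ G i ∩ G j ∣
  ∑-deg-over-edge i = begin
    ∑[ v < n ] (inc i v * deg v)               ≡⟨ sum-cong-≗ (λ v → *-distribˡ-sum (inc i v) (λ j → inc j v)) ⟩
    ∑[ v < n ] ∑[ j < m ] (inc i v * inc j v)  ≡⟨ ∑-comm (λ v j → inc i v * inc j v) ⟩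
    ∑[ j < m ] ∑[ v < n ] (inc i v * inc j v)  ≡⟨ sum-cong-≗ (λ j → ∣p∩q∣≡∑ (G i) (G j)) ⟨
    ∑[ j < m ] ∣ G i ∩ G j ∣                   ∎
    where open ≡-Reasoning

  -- If G i meets every other edge in at most one vertex, then each other edge
  -- contributes at most its indicator of meeting G i, and G i itself |G i|.
  ∑-intersections≤ : ∀ i → (∀ j → i ≢ j → ∣ G i ∩ G j ∣ ≤ 1) →
                     ∑[ j < m ] ∣ G i ∩ G j ∣ ≤ I (G i) G + ∣ G i ∣
  ∑-intersections≤ i nearlyDisjoint = begin
    ∑[ j < m ] ∣ G i ∩ G j ∣                        ≤⟨ ∑-≤-except i (λ j j≢i → meet j (j≢i ∘ sym)) ⟩
    ∑[ j < m ] χ (meets j) + ∣ G i ∩ G i ∣          ≡⟨ cong (_+ ∣ G i ∩ G i ∣) (∣tabulate∣≡∑ meets) ⟨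
    I (G i) G + ∣ G i ∩ G i ∣                       ≤⟨ +-monoʳ-≤ (I (G i) G) (∣p∩q∣≤∣p∣ (G i) (G i)) ⟩
    I (G i) G + ∣ G i ∣                             ∎
    where
    open ≤-Reasoning
    meets : Fin m → Bool
    meets j = does (nonempty? (G i ∩ G j))
    meet : ∀ j → i ≢ j → ∣ G i ∩ G j ∣ ≤ χ (meets j)
    meet j i≢j = ∣p∣≤χ[nonempty] (G i ∩ G j) (nearlyDisjoint j i≢j)

  deg[_] : (Fin m → Bool) → Fin n → ℕ
  deg[ β ] v = ∑[ i < m ] (χ (β i) * inc i v)

  deg[]≤deg : ∀ β v → deg[ β ] v ≤ deg v
  deg[]≤deg β v = ∑-mono-≤ (λ i → ≤-trans (*-monoˡ-≤ (inc i v) (χ≤1 (β i))) (≤-reflexive (*-identityˡ (inc i v))))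

  ∑-deg[] : ∀ β → ∑[ v < n ] deg[ β ] v ≡ ∑[ i < m ] (χ (β i) * ∣ G i ∣)
  ∑-deg[] β = begin
    ∑[ v < n ] ∑[ i < m ] (χ (β i) * inc i v)  ≡⟨ ∑-comm (λ v i → χ (β i) * inc i v) ⟩
    ∑[ i < m ] ∑[ v < n ] (χ (β i) * inc i v)  ≡⟨ sum-cong-≗ (λ i → *-distribˡ-sum (χ (β i)) (inc i)) ⟨
    ∑[ i < m ] (χ (β i) * ∑[ v < n ] inc i v)  ≡⟨ sum-cong-≗ (λ i → cong (χ (β i) *_) (∣p∣≡∑ (G i))) ⟨
    ∑[ i < m ] (χ (β i) * ∣ G i ∣)             ∎
    where open ≡-Reasoning

  -- Σ_v deg[β](v)² ≤ Σ_{i selected} Σ_{v ∈ G i} deg(v): expand one factor of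
  -- the square and bound the other by the full degree.
  ∑-deg[]² : ∀ β → ∑[ v < n ] (deg[ β ] v * deg[ β ] v) ≤ ∑[ i < m ] (χ (β i) * ∑[ v < n ] (inc i v * deg v))
  ∑-deg[]² β = begin
    ∑[ v < n ] (deg[ β ] v * deg[ β ] v)               ≡⟨ sum-cong-≗ (λ v → *-distribʳ-sum (deg[ β ] v) (λ i → χ (β i) * inc i v)) ⟩
    ∑[ v < n ] ∑[ i < m ] (χ (β i) * inc i v * deg[ β ] v)
      ≤⟨ ∑-mono-≤ (λ v → ∑-mono-≤ (λ i → *-monoʳ-≤ (χ (β i) * inc i v) (deg[]≤deg β v))) ⟩
    ∑[ v < n ] ∑[ i < m ] (χ (β i) * inc i v * deg v)  ≡⟨ ∑-comm (λ v i → χ (β i) * inc i v * deg v) ⟩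
    ∑[ i < m ] ∑[ v < n ] (χ (β i) * inc i v * deg v)  ≡⟨ sum-cong-≗ (λ i → sum-cong-≗ (λ v → *-assoc (χ (β i)) (inc i v) (deg v))) ⟩
    ∑[ i < m ] ∑[ v < n ] (χ (β i) * (inc i v * deg v)) ≡⟨ sum-cong-≗ (λ i → *-distribˡ-sum (χ (β i)) (λ v → inc i v * deg v)) ⟨
    ∑[ i < m ] (χ (β i) * ∑[ v < n ] (inc i v * deg v)) ∎
    where open ≤-Reasoning

module SelectedEdges where

  open FiniteSums
  open SubsetCardinality
  open import Data.Nat
  open import Data.Nat.Properties
  open import Data.Bool using (Bool; T)
  open import Data.Fin.Subset using (_∩_; ∣_∣)
  open import Relation.Binary.PropositionalEquality
  open import Function using (_∘_)
  open import Data.Nat.Solver using (module +-*-Solver)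
  open +-*-Solver using (solve; _:*_; _:=_)

  cancel-count : ∀ n c l w → c * l * (c * l) ≤ n * (c * w) → c * l * l ≤ n * w
  cancel-count n zero    l w _ = z≤n
  cancel-count n (suc c) l w h = *-cancelˡ-≤ (suc c) (subst₂ _≤_
    (solve 2 (λ c l → c :* l :* (c :* l) := c :* (c :* l :* l)) refl (suc c) l)
    (solve 3 (λ n c w → n :* (c :* w) := c :* (n :* w)) refl n (suc c) w)
    h)

  selected-edges-bound : ∀ {n m} l (G : Fin m → Subset n) →
    (∀ i → ∣ G i ∣ ≡ l) → (∀ i j → i ≢ j → ∣ G i ∩ G j ∣ ≤ 1) →
    (β : Fin m → Bool) (Y : ℕ) → (∀ i → T (β i) → I (G i) G ≤ Y) →
    (∑[ i < m ] χ (β i)) * l * l ≤ n * (Y + l)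
  selected-edges-bound {n} {m} l G uniform nearlyDisjoint β Y bounded =
    cancel-count n c l (Y + l) (begin
      c * l * (c * l)                                       ≡⟨ cong₂ _*_ selected-size selected-size ⟩
      sum deg[ β ] * sum deg[ β ]                           ≤⟨ cauchy-schwarz deg[ β ] ⟩
      n * ∑[ v < n ] (deg[ β ] v * deg[ β ] v)              ≤⟨ *-monoʳ-≤ n (∑-deg[]² β) ⟩
      n * ∑[ i < m ] (χ (β i) * ∑[ v < n ] (inc i v * deg v)) ≤⟨ *-monoʳ-≤ n (∑-mono-≤ load) ⟩
      n * ∑[ i < m ] (χ (β i) * (Y + l))                    ≡⟨ cong (n *_) (*-distribʳ-sum (Y + l) (χ ∘ β)) ⟨
      n * (c * (Y + l))                                     ∎)
    where
    open Incidences G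
    open ≤-Reasoning
    c : ℕ
    c = ∑[ i < m ] χ (β i)
    selected-size : c * l ≡ sum deg[ β ]
    selected-size = trans (*-distribʳ-sum l (χ ∘ β))
      (trans (sum-cong-≗ (λ i → cong (χ (β i) *_) (sym (uniform i)))) (sym (∑-deg[] β)))
    load : ∀ i → χ (β i) * ∑[ v < n ] (inc i v * deg v) ≤ χ (β i) * (Y + l)
    load i = χ-guard (β i) λ selected → begin
      ∑[ v < n ] (inc i v * deg v)  ≡⟨ ∑-deg-over-edge i ⟩
      ∑[ j < m ] ∣ G i ∩ G j ∣      ≤⟨ ∑-intersections≤ i (nearlyDisjoint i) ⟩
      I (G i) G + ∣ G i ∣           ≤⟨ +-mono-≤ (bounded i selected) (≤-reflexive (uniform i)) ⟩
      Y + l                         ∎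

module RationalArithmetic where

  open import Data.Nat as ℕ using (ℕ; suc)
  import Data.Nat.Properties as ℕ
  open import Data.Integer as ℤ using (+_)
  import Data.Integer.Properties as ℤ
  open import Data.Rational
  open import Data.Rational.Properties
  open import Data.Rational.Unnormalised as ℚᵘ using (ℚᵘ; mkℚᵘ; *≡*)
  import Data.Rational.Unnormalised.Properties as ℚᵘ
  open import Data.Product using (_,_)
  open import Relation.Binary.PropositionalEquality
  open import Data.Rational.Solver using (module +-*-Solver)
  open +-*-Solver using (solve; _:+_; _:*_; _:=_)

  -- Normalisation  fromℚᵘ : ℚᵘ → ℚ  commutes with + and *;  note that
  -- ℕ→ℚ k  is by definition  fromℚᵘ (mkℚᵘ (+ k) 0).
  fromℚᵘ-+ : ∀ p q → fromℚᵘ (p ℚᵘ.+ q) ≡ fromℚᵘ p + fromℚᵘ q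
  fromℚᵘ-+ p q = toℚᵘ-injective (ℚᵘ.≃-trans (toℚᵘ-fromℚᵘ (p ℚᵘ.+ q))
    (ℚᵘ.≃-sym (ℚᵘ.≃-trans (toℚᵘ-homo-+ (fromℚᵘ p) (fromℚᵘ q))
                          (ℚᵘ.+-cong (toℚᵘ-fromℚᵘ p) (toℚᵘ-fromℚᵘ q)))))

  fromℚᵘ-* : ∀ p q → fromℚᵘ (p ℚᵘ.* q) ≡ fromℚᵘ p * fromℚᵘ q
  fromℚᵘ-* p q = toℚᵘ-injective (ℚᵘ.≃-trans (toℚᵘ-fromℚᵘ (p ℚᵘ.* q))
    (ℚᵘ.≃-sym (ℚᵘ.≃-trans (toℚᵘ-homo-* (fromℚᵘ p) (fromℚᵘ q))
                          (ℚᵘ.*-cong (toℚᵘ-fromℚᵘ p) (toℚᵘ-fromℚᵘ q)))))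

  ℕ→ℚᵘ : ℕ → ℚᵘ
  ℕ→ℚᵘ k = mkℚᵘ (+ k) 0

  ℕ→ℚᵘ-+ : ∀ a b → ℕ→ℚᵘ (a ℕ.+ b) ℚᵘ.≃ ℕ→ℚᵘ a ℚᵘ.+ ℕ→ℚᵘ b
  ℕ→ℚᵘ-+ a b = *≡* (cong (ℤ._* ℤ.1ℤ) (trans (ℤ.pos-+ a b)
    (sym (cong₂ ℤ._+_ (ℤ.*-identityʳ (+ a)) (ℤ.*-identityʳ (+ b))))))

  ℕ→ℚᵘ-* : ∀ a b → ℕ→ℚᵘ (a ℕ.* b) ℚᵘ.≃ ℕ→ℚᵘ a ℚᵘ.* ℕ→ℚᵘ b
  ℕ→ℚᵘ-* a b = *≡* (cong (ℤ._* ℤ.1ℤ) (ℤ.pos-* a b))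

  ℕ→ℚ-+ : ∀ a b → ℕ→ℚ (a ℕ.+ b) ≡ ℕ→ℚ a + ℕ→ℚ b
  ℕ→ℚ-+ a b = trans (fromℚᵘ-cong (ℕ→ℚᵘ-+ a b)) (fromℚᵘ-+ (ℕ→ℚᵘ a) (ℕ→ℚᵘ b))

  ℕ→ℚ-* : ∀ a b → ℕ→ℚ (a ℕ.* b) ≡ ℕ→ℚ a * ℕ→ℚ b
  ℕ→ℚ-* a b = trans (fromℚᵘ-cong (ℕ→ℚᵘ-* a b)) (fromℚᵘ-* (ℕ→ℚᵘ a) (ℕ→ℚᵘ b))

  ℕ→ℚ-nonNeg : ∀ a → NonNegative (ℕ→ℚ a)
  ℕ→ℚ-nonNeg a = normalize-nonNeg a 1

  ℕ→ℚ-pos : ∀ a .{{_ : ℕ.NonZero a}} → Positive (ℕ→ℚ a)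
  ℕ→ℚ-pos a = normalize-pos a 1

  ℕ→ℚ-mono-≤ : ∀ {a b} → a ℕ.≤ b → ℕ→ℚ a ≤ ℕ→ℚ b
  ℕ→ℚ-mono-≤ {a} a≤b with d , refl ← ℕ.m≤n⇒∃[o]m+o≡n a≤b = begin
    ℕ→ℚ a           ≡⟨ +-identityʳ (ℕ→ℚ a) ⟨
    ℕ→ℚ a + 0ℚ      ≤⟨ +-monoʳ-≤ (ℕ→ℚ a) (nonNegative⁻¹ (ℕ→ℚ d) {{ℕ→ℚ-nonNeg d}}) ⟩
    ℕ→ℚ a + ℕ→ℚ d   ≡⟨ ℕ→ℚ-+ a d ⟨
    ℕ→ℚ (a ℕ.+ d)   ∎
    where open ≤-Reasoning

  /-*-cancel : ∀ a b .{{_ : ℕ.NonZero b}} → ((+ a) / b) * ℕ→ℚ b ≡ ℕ→ℚ a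
  /-*-cancel a b@(suc b-1) = trans (sym (fromℚᵘ-* (mkℚᵘ (+ a) b-1) (ℕ→ℚᵘ b))) (fromℚᵘ-cong fraction)
    where
    fraction : mkℚᵘ (+ a) b-1 ℚᵘ.* ℕ→ℚᵘ b ℚᵘ.≃ ℕ→ℚᵘ a
    fraction = *≡* (trans (ℤ.*-identityʳ (+ a ℤ.* + b))
                          (cong (λ d → + a ℤ.* + suc d) (sym (ℕ.*-identityʳ b-1))))

  count-bound : ∀ n l m c Y .{{_ : ℕ.NonZero n}} .{{_ : ℕ.NonZero l}} (δ : ℚ) →
    c ℕ.* l ℕ.* l ℕ.≤ n ℕ.* (Y ℕ.+ l) → ℕ→ℚ Y < δ * ((+ (m ℕ.* l ℕ.* l)) / n) →
    ℕ→ℚ c < δ * ℕ→ℚ m + (+ n) / l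
  count-bound n l m c Y δ counting Y<δZ = *-cancelʳ-<-nonNeg (L * L) {{L²-nonNeg}} (begin-strict
    C * (L * L)                ≡⟨ cast-c·l² ⟨
    ℕ→ℚ (c ℕ.* l ℕ.* l)        ≤⟨ ℕ→ℚ-mono-≤ counting ⟩
    ℕ→ℚ (n ℕ.* (Y ℕ.+ l))      ≡⟨ trans (ℕ→ℚ-* n (Y ℕ.+ l)) (cong (N *_) (ℕ→ℚ-+ Y l)) ⟩
    N * (ℕ→ℚ Y + L)            <⟨ *-monoʳ-<-pos N {{ℕ→ℚ-pos n}} (+-monoˡ-< L Y<δZ) ⟩
    N * (δ * Z + L)            ≡⟨ solve 4 (λ N δ Z L → N :* (δ :* Z :+ L) := δ :* (Z :* N) :+ N :* L) refl N δ Z L ⟩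
    δ * (Z * N) + N * L        ≡⟨ cong₂ (λ x y → δ * x + y * L) ZN (sym (/-*-cancel n l)) ⟩
    δ * (M * L * L) + W * L * L ≡⟨ solve 4 (λ δ M L W → δ :* (M :* L :* L) :+ W :* L :* L
                                            := (δ :* M :+ W) :* (L :* L)) refl δ M L W ⟩
    (δ * M + W) * (L * L)      ∎)
    where
    open ≤-Reasoning
    C = ℕ→ℚ c
    L = ℕ→ℚ l
    M = ℕ→ℚ m
    N = ℕ→ℚ n
    Z = (+ (m ℕ.* l ℕ.* l)) / n
    W = (+ n) / l
    L²-nonNeg : NonNegative (L * L)
    L²-nonNeg = nonNeg*nonNeg⇒nonNeg L {{ℕ→ℚ-nonNeg l}} L {{ℕ→ℚ-nonNeg l}}
    cast-c·l² : ℕ→ℚ (c ℕ.* l ℕ.* l) ≡ C * (L * L)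
    cast-c·l² = trans (ℕ→ℚ-* (c ℕ.* l) l) (trans (cong (_* L) (ℕ→ℚ-* c l)) (*-assoc C L L))
    ZN : Z * N ≡ M * L * L
    ZN = trans (/-*-cancel (m ℕ.* l ℕ.* l) n) (trans (ℕ→ℚ-* (m ℕ.* l) l) (cong (_* L) (ℕ→ℚ-* m l)))

  count-bound-pos : ∀ n l m .{{_ : ℕ.NonZero n}} .{{_ : ℕ.NonZero l}} (δ : ℚ) → Positive δ →
    0ℚ < δ * ℕ→ℚ m + (+ n) / l
  count-bound-pos n l m δ δ>0 = +-mono-≤-< (nonNegative⁻¹ (δ * ℕ→ℚ m) {{δm-nonNeg}}) (positive⁻¹ ((+ n) / l) {{normalize-pos n l}})
    where
    δm-nonNeg : NonNegative (δ * ℕ→ℚ m)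
    δm-nonNeg = nonNeg*nonNeg⇒nonNeg δ {{pos⇒nonNeg δ {{δ>0}}}} (ℕ→ℚ m) {{ℕ→ℚ-nonNeg m}}

open FiniteSums using (sum-syntax)
open SubsetCardinality using (χ; ∣tabulate∣≡∑; ∑χ-none)
open Selection using (does-sound; selected-max)
open SelectedEdges using (selected-edges-bound)
open RationalArithmetic using (count-bound; count-bound-pos)
import Data.Nat as ℕ
open import Data.Nat using (NonZero; _≤_)
open import Data.Bool using (Bool; T)
open import Data.Integer using (+_)
open import Data.Rational using (ℚ; Positive; _/_; _+_; _*_; _<_; _<?_)
open import Data.Product using (_,_; _×_; ∃-syntax)
open import Data.Sum using ([_,_]′)
open import Relation.Nullary using (does; ¬_)
open import Relation.Binary.PropositionalEquality using (_≡_; sym; subst)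

-- If there is a low edge, take one, e₀, of largest intersection number
-- Y = I(e₀,G); the core estimate gives  c·l² ≤ n·(Y + l),  which in ℚ is the
-- claim since Y is below the threshold.  Otherwise c = 0 and the claim is
-- positivity of the bound.
proposition4p1 : (n l m : ℕ) → .{{_ : NonZero n}} → .{{_ : NonZero l}}
    → (G : Fin m → Subset n) → IsNearlyDisjointUniform l G
    → (δ : ℚ) → Positive δ
    → ℕ→ℚ (lowCount l δ G) < δ * ℕ→ℚ m + (+ n) / l
proposition4p1 n l m G (_ , uniform , nearlyDisjoint) δ δ>0 =
  subst (λ k → ℕ→ℚ k < bound) (sym lowCount≡c)
    ([ no-low-edge , largest-low-edge ]′ (selected-max low (λ e → I (G e) G)))
  where
  threshold bound : ℚ
  threshold = δ * ((+ (m ℕ.* l ℕ.* l)) / n)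
  bound = δ * ℕ→ℚ m + (+ n) / l
  low : Fin m → Bool
  low e = does (ℕ→ℚ (I (G e) G) <? threshold)
  c : ℕ
  c = ∑[ e < m ] χ (low e)
  lowCount≡c : lowCount l δ G ≡ c
  lowCount≡c = ∣tabulate∣≡∑ low
  no-low-edge : (∀ e → ¬ T (low e)) → ℕ→ℚ c < bound
  no-low-edge none = subst (λ k → ℕ→ℚ k < bound) (sym (∑χ-none low none)) (count-bound-pos n l m δ δ>0)
  largest-low-edge : ∃[ e₀ ] (T (low e₀) × (∀ e → T (low e) → I (G e) G ≤ I (G e₀) G)) → ℕ→ℚ c < bound
  largest-low-edge (e₀ , e₀-low , e₀-max) = count-bound n l m c (I (G e₀) G) δ
    (selected-edges-bound l G uniform nearlyDisjoint low (I (G e₀) G) e₀-max)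
    (does-sound (ℕ→ℚ (I (G e₀) G) <? threshold) e₀-low)
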